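{- Let $G$ be a finite simple graph of order $n\geq 3$ and let $k\in\{3,\ldots,n\}$ be an integer. Then $C_{k}(G)\leq n-k+2$. Moreover, equality $C_k(G)=n-k+2$ holds if and only if $n=k$ or $G\cong H\vee K_{n-k+1}$ for some graph $H$ of order $k-1$.
   Context: For a positive integer $k$, a set $S\subseteq V(G)$ is a $k$-dominating set of $G$ if every vertex $v\in V(G)\setminus S$ has at least $k$ neighbors in $S$. Two disjoint sets $A,B\subseteq V(G)$ form a $k$-coalition if neither $A$ nor $B$ is a $k$-dominating set of $G$ but $A\cup B$ is a $k$-dominating set of $G$. A $k$-coalition partition of $G$ is a partition $\Theta$ of $V(G)$ such that every set in $\Theta$ is either a $k$-dominating set of cardinality $k$ or forms a $k$-coalition with another set of $\Theta$. The $k$-coalition number $C_k(G)$ is the maximum cardinality of a $k$-coalition partition of $G$. The join $G\vee H$ of graphs $G$ and $H$ is obtained from their disjoint union by adding all edges $gh$ with $g\in V(G)$, $h\in V(H)$. -}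

module Defs where

open import Data.Nat using (ℕ; _≤_; _+_; _∸_)
open import Data.Bool using (Bool; true; false)
open import Data.Fin using (Fin; splitAt; _≟_)
open import Data.Fin.Subset using (Subset; _∈_; _∉_; _∩_; _∪_; ∣_∣; Empty)
open import Data.Vec using (tabulate)
open import Data.Sum using (_⊎_; inj₁; inj₂)
open import Data.Product using (Σ; _×_; ∃)
open import Relation.Nullary using (¬_; yes; no)
open import Data.Empty using (⊥-elim)
open import Relation.Nullary.Decidable using (⌊_⌋)
open import Relation.Binary.PropositionalEquality using (_≡_; _≢_; refl)
import Relation.Binary.PropositionalEquality as P
open import Function using (Surjective)
open import Function.Bundles using (_↔_; Inverse)

record Graph (n : ℕ) : Set where
  field
    adj   : Fin n → Fin n → Bool
    sym   : ∀ u v → adj u v ≡ adj v u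
    irrefl : ∀ v → adj v v ≡ false
open Graph public

N : ∀ {n} → Graph n → Fin n → Subset n
N G v = tabulate (adj G v)

KDominating : ∀ {n} → Graph n → ℕ → Subset n → Set
KDominating G k S = ∀ v → v ∉ S → k ≤ ∣ S ∩ N G v ∣

Disjoint : ∀ {n} → Subset n → Subset n → Set
Disjoint A B = Empty (A ∩ B)

KCoalition : ∀ {n} → Graph n → ℕ → Subset n → Subset n → Set
KCoalition G k A B =
  Disjoint A B × ¬ KDominating G k A × ¬ KDominating G k B × KDominating G k (A ∪ B)

-- A partition of V(G) into m (nonempty) classes is given by a surjective
-- class map f : Fin n → Fin m; the i-th class is its preimage of i.
part : ∀ {n m} → (Fin n → Fin m) → Fin m → Subset n
part f i = tabulate (λ v → ⌊ f v ≟ i ⌋)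

IsKCoalitionPartition : ∀ {n m} → Graph n → ℕ → (Fin n → Fin m) → Set
IsKCoalitionPartition {m = m} G k f =
  Surjective _≡_ _≡_ f ×
  (∀ i → (KDominating G k (part f i) × ∣ part f i ∣ ≡ k)
         ⊎ Σ (Fin m) (λ j → j ≢ i × KCoalition G k (part f i) (part f j)))

IsCoalitionNumber : ∀ {n} → Graph n → ℕ → ℕ → Set
IsCoalitionNumber {n} G k c =
  Σ (Fin n → Fin c) (IsKCoalitionPartition G k) ×
  (∀ m (f : Fin n → Fin m) → IsKCoalitionPartition G k f → m ≤ c)

kadj : ∀ {m} → Fin m → Fin m → Bool
kadj u v with u ≟ v
... | yes _ = false
... | no _ = true

kadj-sym : ∀ {m} (u v : Fin m) → kadj u v ≡ kadj v u
kadj-sym u v with u ≟ v | v ≟ u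
... | yes _ | yes _ = refl
... | no _ | no _ = refl
... | yes p | no q = ⊥-elim (q (P.sym p))
... | no p | yes q = ⊥-elim (p (P.sym q))

kadj-irr : ∀ {m} (v : Fin m) → kadj v v ≡ false
kadj-irr v with v ≟ v
... | yes _ = refl
... | no q = ⊥-elim (q refl)

complete : (m : ℕ) → Graph m
complete m = record { adj = kadj ; sym = kadj-sym ; irrefl = kadj-irr }

-- join G ∨ H on vertex set Fin (a + b): the first a vertices are G,
-- the last b are H, and every G-vertex is adjacent to every H-vertex.
jadj : ∀ {a b} → Graph a → Graph b → Fin a ⊎ Fin b → Fin a ⊎ Fin b → Bool
jadj G H (inj₁ x) (inj₁ y) = adj G x y
jadj G H (inj₂ x) (inj₂ y) = adj H x y
jadj G H (inj₁ _) (inj₂ _) = true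
jadj G H (inj₂ _) (inj₁ _) = true

jadj-sym : ∀ {a b} (G : Graph a) (H : Graph b) u v → jadj G H u v ≡ jadj G H v u
jadj-sym G H (inj₁ x) (inj₁ y) = sym G x y
jadj-sym G H (inj₂ x) (inj₂ y) = sym H x y
jadj-sym G H (inj₁ _) (inj₂ _) = refl
jadj-sym G H (inj₂ _) (inj₁ _) = refl

jadj-irr : ∀ {a b} (G : Graph a) (H : Graph b) u → jadj G H u u ≡ false
jadj-irr G H (inj₁ x) = irrefl G x
jadj-irr G H (inj₂ x) = irrefl H x

join : ∀ {a b} → Graph a → Graph b → Graph (a + b)
join {a} G H = record
  { adj = λ u v → jadj G H (splitAt a u) (splitAt a v)
  ; sym = λ u v → jadj-sym G H (splitAt a u) (splitAt a v)
  ; irrefl = λ u → jadj-irr G H (splitAt a u) }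

_≅_ : ∀ {n m} → Graph n → Graph m → Set
_≅_ {n} {m} G H = Σ (Fin n ↔ Fin m) λ σ →
  ∀ u v → adj G u v ≡ adj H (Inverse.to σ u) (Inverse.to σ v)

-- If a class V is k-dominating of size k, or V ∪ W is k-dominating for another class W, then V
-- (resp. V ∪ W) has at least k vertices while the remaining classes are nonempty, so a k-coalition
-- partition has at most n − k + 2 classes. In a partition attaining this bound with n > k, every
-- class has fewer than k vertices, hence needs a coalition partner, and every class outside a
-- coalition pair is a singleton. By pigeonhole some class C has two vertices, so C belongs to every
-- coalition pair: all other classes are singletons {w}, |C| = k − 1, and each C ∪ {w} is a
-- k-dominating set of exactly k vertices. A vertex outside such a set is adjacent to all of it, so
-- every vertex outside C is universal, i.e. G ≅ G[C] ∨ K_{n−k+1}. Conversely, for such a join (and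
-- for n = k, taking C = V − {v}) the partition of V into C and singletons attains the bound.
module Submission where

open import Defs hiding (sym)

open import Algebra.Properties.CommutativeSemigroup using (x∙yz≈y∙xz)
open import Data.Bool using (Bool; true; false)
open import Data.Bool.Properties using (T-≡)
import Data.Fin as Fin
open import Data.Fin using (Fin; zero; suc; _≟_; splitAt; _↑ˡ_)
import Data.Fin.Properties as Finₚ
open import Data.Fin.Properties using (splitAt-join; join-splitAt; pigeonhole)
open import Data.Fin.Subset
open import Data.Fin.Subset.Properties
import Data.Nat as ℕ
open import Data.Nat using (ℕ; zero; suc; _≤_; _<_; _+_; _∸_; z≤n; s≤s; _<?_)
open import Data.Nat.Properties
  using ( +-suc; +-identityʳ; +-comm; +-assoc; +-commutativeSemigroup; +-∸-comm; m+[n∸m]≡n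
        ; ≤-reflexive; ≤-trans; ≤-antisym; ≤-pred; <⇒≤; ≤-<-trans; <⇒≢; <⇒≱; ≮⇒≥; ≤∧≢⇒<
        ; m≤m+n; +-mono-≤; +-monoˡ-≤; +-monoʳ-≤; +-cancelˡ-≤; +-cancelʳ-≤
        ; m+n≤o⇒m≤o∸n; m<n⇒0<n∸m; module ≤-Reasoning )
import Data.Product as Product
open import Data.Product using (Σ; _×_; ∃; _,_; proj₁; proj₂)
import Data.Sum as Sum
open import Data.Sum using (_⊎_; inj₁; inj₂; map₁; map₂; [_,_]′)
open import Data.Sum.Properties using (inj₂-injective)
open import Data.Vec using ([]; _∷_; _++_; tabulate; here; there)
open import Data.Vec.Properties using (lookup∘tabulate; []=⇒lookup; lookup⇒[]=)
open import Function using (_∘_; const)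
open import Function.Bundles using (Equivalence; Inverse; _↔_; mk↔ₛ′; _⇔_; mk⇔)
open import Function.Definitions using (Surjective)
open import Level using (Level)
open import Relation.Binary.PropositionalEquality
open import Relation.Nullary using (¬_; yes; no; contradiction)
open import Relation.Nullary.Decidable using (⌊_⌋; toWitness; fromWitness)
open import Relation.Unary using (Pred; Decidable)

private
  variable
    ℓ : Level
    n m : ℕ
    p q : Subset n

-- Cardinalities of subsets

∣p∪q∣+∣p∩q∣≡∣p∣+∣q∣ : ∀ (p q : Subset n) → ∣ p ∪ q ∣ + ∣ p ∩ q ∣ ≡ ∣ p ∣ + ∣ q ∣
∣p∪q∣+∣p∩q∣≡∣p∣+∣q∣ []          []          = refl
∣p∪q∣+∣p∩q∣≡∣p∣+∣q∣ (true  ∷ p) (true  ∷ q) = cong suc (begin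
  ∣ p ∪ q ∣ + suc ∣ p ∩ q ∣   ≡⟨ +-suc _ _ ⟩
  suc (∣ p ∪ q ∣ + ∣ p ∩ q ∣) ≡⟨ cong suc (∣p∪q∣+∣p∩q∣≡∣p∣+∣q∣ p q) ⟩
  suc (∣ p ∣ + ∣ q ∣)         ≡⟨ +-suc _ _ ⟨
  ∣ p ∣ + suc ∣ q ∣           ∎)
  where open ≡-Reasoning
∣p∪q∣+∣p∩q∣≡∣p∣+∣q∣ (true  ∷ p) (false ∷ q) = cong suc (∣p∪q∣+∣p∩q∣≡∣p∣+∣q∣ p q)
∣p∪q∣+∣p∩q∣≡∣p∣+∣q∣ (false ∷ p) (true  ∷ q) =
  trans (cong suc (∣p∪q∣+∣p∩q∣≡∣p∣+∣q∣ p q)) (sym (+-suc _ _))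
∣p∪q∣+∣p∩q∣≡∣p∣+∣q∣ (false ∷ p) (false ∷ q) = ∣p∪q∣+∣p∩q∣≡∣p∣+∣q∣ p q

∣p∪q∣≤∣p∣+∣q∣ : ∀ (p q : Subset n) → ∣ p ∪ q ∣ ≤ ∣ p ∣ + ∣ q ∣
∣p∪q∣≤∣p∣+∣q∣ p q = ≤-trans (m≤m+n _ _) (≤-reflexive (∣p∪q∣+∣p∩q∣≡∣p∣+∣q∣ p q))

∣p∪q∣≡∣p∣+∣q∣ : Disjoint p q → ∣ p ∪ q ∣ ≡ ∣ p ∣ + ∣ q ∣
∣p∪q∣≡∣p∣+∣q∣ {n} {p} {q} p∩q-empty = begin
  ∣ p ∪ q ∣              ≡⟨ +-identityʳ _ ⟨
  ∣ p ∪ q ∣ + 0          ≡⟨ cong (∣ p ∪ q ∣ +_) (∣⊥∣≡0 n) ⟨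
  ∣ p ∪ q ∣ + ∣ ⊥ {n} ∣  ≡⟨ cong (λ r → ∣ p ∪ q ∣ + ∣ r ∣) (Empty-unique p∩q-empty) ⟨
  ∣ p ∪ q ∣ + ∣ p ∩ q ∣  ≡⟨ ∣p∪q∣+∣p∩q∣≡∣p∣+∣q∣ p q ⟩
  ∣ p ∣ + ∣ q ∣          ∎
  where open ≡-Reasoning

∣p∣+∣∁p∣≡n : ∀ (p : Subset n) → ∣ p ∣ + ∣ ∁ p ∣ ≡ n
∣p∣+∣∁p∣≡n p = trans (cong (∣ p ∣ +_) (∣∁p∣≡n∸∣p∣ p)) (m+[n∸m]≡n (∣p∣≤n p))

0<∣p∣⇒∃∈ : ∀ (p : Subset n) → 0 < ∣ p ∣ → ∃ λ x → x ∈ p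
0<∣p∣⇒∃∈ {n} p 0<∣p∣ with nonempty? p
... | yes ∃∈ = ∃∈
... | no p-empty = contradiction (trans (cong ∣_∣ (Empty-unique p-empty)) (∣⊥∣≡0 n)) (≢-sym (<⇒≢ 0<∣p∣))

∣p∣<n⇒∃∉ : ∀ (p : Subset n) → ∣ p ∣ < n → ∃ λ x → x ∉ p
∣p∣<n⇒∃∉ p ∣p∣<n = Product.map₂ x∈∁p⇒x∉p
  (0<∣p∣⇒∃∈ (∁ p) (subst (0 <_) (sym (∣∁p∣≡n∸∣p∣ p)) (m<n⇒0<n∸m ∣p∣<n)))

x∈⁅y⁆∪⁅z⁆⁺ : ∀ {x y z : Fin n} → x ≡ y ⊎ x ≡ z → x ∈ ⁅ y ⁆ ∪ ⁅ z ⁆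
x∈⁅y⁆∪⁅z⁆⁺ (inj₁ refl) = x∈p∪q⁺ (inj₁ (x∈⁅x⁆ _))
x∈⁅y⁆∪⁅z⁆⁺ (inj₂ refl) = x∈p∪q⁺ (inj₂ (x∈⁅x⁆ _))

∣⁅x⁆∪⁅y⁆∣≤2 : ∀ (x y : Fin n) → ∣ ⁅ x ⁆ ∪ ⁅ y ⁆ ∣ ≤ 2
∣⁅x⁆∪⁅y⁆∣≤2 x y = ≤-trans (∣p∪q∣≤∣p∣+∣q∣ ⁅ x ⁆ ⁅ y ⁆)
  (≤-reflexive (cong₂ _+_ (∣⁅x⁆∣≡1 x) (∣⁅x⁆∣≡1 y)))

x∉p⇒Disjoint : ∀ {x : Fin n} → x ∉ p → Disjoint p ⁅ x ⁆
x∉p⇒Disjoint {p = p} {x} x∉p (y , y∈p∩⁅x⁆) with x∈p∩q⁻ p ⁅ x ⁆ y∈p∩⁅x⁆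
... | y∈p , y∈⁅x⁆ = x∉p (subst (_∈ p) (x∈⁅y⁆⇒x≡y x y∈⁅x⁆) y∈p)

∣⁅x⁆∪⁅y⁆∣≡2 : ∀ {x y : Fin n} → x ≢ y → ∣ ⁅ x ⁆ ∪ ⁅ y ⁆ ∣ ≡ 2
∣⁅x⁆∪⁅y⁆∣≡2 {x = x} {y} x≢y = trans (∣p∪q∣≡∣p∣+∣q∣ (x∉p⇒Disjoint (x≢y⇒x∉⁅y⁆ (≢-sym x≢y))))
  (cong₂ _+_ (∣⁅x⁆∣≡1 x) (∣⁅x⁆∣≡1 y))

∃≢₂ : 2 < m → (x y : Fin m) → ∃ λ z → z ≢ x × z ≢ y
∃≢₂ 2<m x y with ∣p∣<n⇒∃∉ (⁅ x ⁆ ∪ ⁅ y ⁆) (≤-<-trans (∣⁅x⁆∪⁅y⁆∣≤2 x y) 2<m)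
... | z , z∉⁅x⁆∪⁅y⁆ = z , z∉⁅x⁆∪⁅y⁆ ∘ x∈⁅y⁆∪⁅z⁆⁺ ∘ inj₁ , z∉⁅x⁆∪⁅y⁆ ∘ x∈⁅y⁆∪⁅z⁆⁺ ∘ inj₂

∣p∣≤1⇒≡ : ∣ p ∣ ≤ 1 → ∀ {x y} → x ∈ p → y ∈ p → x ≡ y
∣p∣≤1⇒≡ {p = p} ∣p∣≤1 {x} {y} x∈p y∈p with x ≟ y
... | yes x≡y = x≡y
... | no x≢y = contradiction (≤-trans 2≤∣p∣ ∣p∣≤1) λ { (s≤s ()) }
  where
  ⁅x⁆∪⁅y⁆⊆p : ⁅ x ⁆ ∪ ⁅ y ⁆ ⊆ p
  ⁅x⁆∪⁅y⁆⊆p z∈ with x∈p∪q⁻ ⁅ x ⁆ ⁅ y ⁆ z∈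
  ... | inj₁ z∈⁅x⁆ = subst (_∈ p) (sym (x∈⁅y⁆⇒x≡y x z∈⁅x⁆)) x∈p
  ... | inj₂ z∈⁅y⁆ = subst (_∈ p) (sym (x∈⁅y⁆⇒x≡y y z∈⁅y⁆)) y∈p
  2≤∣p∣ : 2 ≤ ∣ p ∣
  2≤∣p∣ = subst (_≤ ∣ p ∣) (∣⁅x⁆∪⁅y⁆∣≡2 x≢y) (p⊆q⇒∣p∣≤∣q∣ ⁅x⁆∪⁅y⁆⊆p)

∣p∪⁅x⁆∣≡1+∣p∣ : ∀ {x : Fin n} → x ∉ p → ∣ p ∪ ⁅ x ⁆ ∣ ≡ suc ∣ p ∣
∣p∪⁅x⁆∣≡1+∣p∣ {p = p} {x} x∉p =
  trans (∣p∪q∣≡∣p∣+∣q∣ (x∉p⇒Disjoint x∉p)) (trans (cong (∣ p ∣ +_) (∣⁅x⁆∣≡1 x)) (+-comm ∣ p ∣ 1))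

1+∣∁⁅x⁆∣≡n : ∀ (x : Fin n) → suc ∣ ∁ ⁅ x ⁆ ∣ ≡ n
1+∣∁⁅x⁆∣≡n {suc n} x = cong suc (trans (∣∁p∣≡n∸∣p∣ ⁅ x ⁆) (cong (suc n ∸_) (∣⁅x⁆∣≡1 x)))

x∉∁⁅y⁆⇒z∈∁⁅y⁆∪⁅x⁆ : ∀ {x y : Fin n} → x ∉ ∁ ⁅ y ⁆ → ∀ z → z ∈ ∁ ⁅ y ⁆ ∪ ⁅ x ⁆
x∉∁⁅y⁆⇒z∈∁⁅y⁆∪⁅x⁆ {x = x} {y} x∉∁⁅y⁆ z with z ≟ y
... | yes refl = x∈p∪q⁺ (inj₂ (subst (_∈ ⁅ x ⁆) (x∈⁅y⁆⇒x≡y z (x∉∁p⇒x∈p x∉∁⁅y⁆)) (x∈⁅x⁆ x)))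
... | no z≢y   = x∈p∪q⁺ (inj₁ (x∉p⇒x∈∁p (x≢y⇒x∉⁅y⁆ z≢y)))

∣p∣≤∣p∩q∣⇒p⊆q : ∣ p ∣ ≤ ∣ p ∩ q ∣ → p ⊆ q
∣p∣≤∣p∩q∣⇒p⊆q {p = p} {q} ∣p∣≤∣p∩q∣ {x} x∈p with x ∈? q
... | yes x∈q = x∈q
... | no x∉q = contradiction ∣p∣≤∣p∩q∣ (<⇒≱ (p⊂q⇒∣p∣<∣q∣ p∩q⊂p))
  where
  p∩q⊂p : p ∩ q ⊂ p
  p∩q⊂p = p∩q⊆p p q , x , x∈p , x∉q ∘ proj₂ ∘ x∈p∩q⁻ p q

-- Classes, preimages and images

module _ {g : Fin n → Bool} {x : Fin n} where

  ∈-tabulate⁺ : g x ≡ true → x ∈ tabulate g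
  ∈-tabulate⁺ gx≡true = lookup⇒[]= x (tabulate g) (trans (lookup∘tabulate g x) gx≡true)

  ∈-tabulate⁻ : x ∈ tabulate g → g x ≡ true
  ∈-tabulate⁻ x∈ = trans (sym (lookup∘tabulate g x)) ([]=⇒lookup x∈)

module _ {P : Pred (Fin n) ℓ} (P? : Decidable P) {x : Fin n} where

  ∈-select⁺ : P x → x ∈ tabulate (λ y → ⌊ P? y ⌋)
  ∈-select⁺ = ∈-tabulate⁺ ∘ Equivalence.to T-≡ ∘ fromWitness

  ∈-select⁻ : x ∈ tabulate (λ y → ⌊ P? y ⌋) → P x
  ∈-select⁻ = toWitness ∘ Equivalence.from T-≡ ∘ ∈-tabulate⁻

module _ {f : Fin n → Fin m} {i : Fin m} {v : Fin n} where

  ∈-part⁺ : f v ≡ i → v ∈ part f i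
  ∈-part⁺ = ∈-select⁺ (λ u → f u ≟ i)

  ∈-part⁻ : v ∈ part f i → f v ≡ i
  ∈-part⁻ = ∈-select⁻ (λ u → f u ≟ i)

preimage : (Fin n → Fin m) → Subset m → Subset n
preimage f D = tabulate (λ v → ⌊ f v ∈? D ⌋)

module _ {f : Fin n → Fin m} {D : Subset m} {v : Fin n} where

  ∈-preimage⁺ : f v ∈ D → v ∈ preimage f D
  ∈-preimage⁺ = ∈-select⁺ (λ u → f u ∈? D)

  ∈-preimage⁻ : v ∈ preimage f D → f v ∈ D
  ∈-preimage⁻ = ∈-select⁻ (λ u → f u ∈? D)

preimage-∁ : ∀ (f : Fin n → Fin m) D → preimage f (∁ D) ≡ ∁ (preimage f D)
preimage-∁ f D = ⊆-antisym
  (λ v∈f⁻¹∁D → x∉p⇒x∈∁p λ v∈f⁻¹D → x∈∁p⇒x∉p (∈-preimage⁻ v∈f⁻¹∁D) (∈-preimage⁻ v∈f⁻¹D))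
  (λ v∈∁f⁻¹D → ∈-preimage⁺ (x∉p⇒x∈∁p λ fv∈D → x∈∁p⇒x∉p v∈∁f⁻¹D (∈-preimage⁺ fv∈D)))

image : (Fin n → Fin m) → Subset n → Subset m
image f []          = ⊥
image f (true ∷ p)  = ⁅ f zero ⁆ ∪ image (f ∘ suc) p
image f (false ∷ p) = image (f ∘ suc) p

∈-image⁺ : ∀ (f : Fin n → Fin m) {p x} → x ∈ p → f x ∈ image f p
∈-image⁺ f {true  ∷ p} here        = x∈p∪q⁺ (inj₁ (x∈⁅x⁆ (f zero)))
∈-image⁺ f {true  ∷ p} (there x∈p) = x∈p∪q⁺ (inj₂ (∈-image⁺ (f ∘ suc) x∈p))
∈-image⁺ f {false ∷ p} (there x∈p) = ∈-image⁺ (f ∘ suc) x∈p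

∣image∣≤∣p∣ : ∀ (f : Fin n → Fin m) p → ∣ image f p ∣ ≤ ∣ p ∣
∣image∣≤∣p∣ {m = m} f []  = ≤-reflexive (∣⊥∣≡0 m)
∣image∣≤∣p∣ f (true ∷ p)  = begin
  ∣ ⁅ f zero ⁆ ∪ image (f ∘ suc) p ∣       ≤⟨ ∣p∪q∣≤∣p∣+∣q∣ ⁅ f zero ⁆ (image (f ∘ suc) p) ⟩
  ∣ ⁅ f zero ⁆ ∣ + ∣ image (f ∘ suc) p ∣   ≡⟨ cong (_+ ∣ image (f ∘ suc) p ∣) (∣⁅x⁆∣≡1 (f zero)) ⟩
  suc ∣ image (f ∘ suc) p ∣                ≤⟨ s≤s (∣image∣≤∣p∣ (f ∘ suc) p) ⟩
  suc ∣ p ∣                                ∎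
  where open ≤-Reasoning
∣image∣≤∣p∣ f (false ∷ p) = ∣image∣≤∣p∣ (f ∘ suc) p

module _ {f : Fin n → Fin m} where

  surjective⇒∣D∣≤∣preimage∣ : Surjective _≡_ _≡_ f → ∀ D → ∣ D ∣ ≤ ∣ preimage f D ∣
  surjective⇒∣D∣≤∣preimage∣ surj D =
    ≤-trans (p⊆q⇒∣p∣≤∣q∣ D⊆image) (∣image∣≤∣p∣ f (preimage f D))
    where
    D⊆image : D ⊆ image f (preimage f D)
    D⊆image {i} i∈D with surj i
    ... | v , fv≡i = subst (_∈ image f (preimage f D)) (fv≡i refl)
      (∈-image⁺ f (∈-preimage⁺ (subst (_∈ D) (sym (fv≡i refl)) i∈D)))

  leftInverse⇒∣preimage∣≤∣D∣ : (g : Fin m → Fin n) → (∀ v → g (f v) ≡ v) → ∀ D → ∣ preimage f D ∣ ≤ ∣ D ∣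
  leftInverse⇒∣preimage∣≤∣D∣ g g∘f≡id D = ≤-trans (p⊆q⇒∣p∣≤∣q∣ preimage⊆image) (∣image∣≤∣p∣ g D)
    where
    preimage⊆image : preimage f D ⊆ image g D
    preimage⊆image {v} v∈f⁻¹D = subst (_∈ image g D) (g∘f≡id v) (∈-image⁺ g (∈-preimage⁻ v∈f⁻¹D))

  surjective⇒∣preimage∣+m≤n+∣D∣ : Surjective _≡_ _≡_ f → ∀ D → ∣ preimage f D ∣ + m ≤ n + ∣ D ∣
  surjective⇒∣preimage∣+m≤n+∣D∣ surj D = begin
    ∣ f⁻¹D ∣ + m
      ≡⟨ cong (∣ f⁻¹D ∣ +_) (∣p∣+∣∁p∣≡n D) ⟨
    ∣ f⁻¹D ∣ + (∣ D ∣ + ∣ ∁ D ∣)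
      ≤⟨ +-monoʳ-≤ (∣ f⁻¹D ∣) (+-monoʳ-≤ (∣ D ∣) (surjective⇒∣D∣≤∣preimage∣ surj (∁ D))) ⟩
    ∣ f⁻¹D ∣ + (∣ D ∣ + ∣ preimage f (∁ D) ∣)
      ≡⟨ cong (λ r → ∣ f⁻¹D ∣ + (∣ D ∣ + ∣ r ∣)) (preimage-∁ f D) ⟩
    ∣ f⁻¹D ∣ + (∣ D ∣ + ∣ ∁ f⁻¹D ∣)
      ≡⟨ x∙yz≈y∙xz +-commutativeSemigroup (∣ f⁻¹D ∣) (∣ D ∣) (∣ ∁ f⁻¹D ∣) ⟩
    ∣ D ∣ + (∣ f⁻¹D ∣ + ∣ ∁ f⁻¹D ∣)
      ≡⟨ cong (∣ D ∣ +_) (∣p∣+∣∁p∣≡n f⁻¹D) ⟩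
    ∣ D ∣ + n
      ≡⟨ +-comm (∣ D ∣) n ⟩
    n + ∣ D ∣
      ∎
    where
    open ≤-Reasoning
    f⁻¹D = preimage f D

-- Splitting the vertex set along a subset, and joins

toSide : (U : Subset n) → Fin n → Fin ∣ U ∣ ⊎ Fin ∣ ∁ U ∣
toSide (true  ∷ U) zero    = inj₁ zero
toSide (false ∷ U) zero    = inj₂ zero
toSide (true  ∷ U) (suc v) = map₁ suc (toSide U v)
toSide (false ∷ U) (suc v) = map₂ suc (toSide U v)

fromSide : (U : Subset n) → Fin ∣ U ∣ ⊎ Fin ∣ ∁ U ∣ → Fin n
fromSide (true  ∷ U) (inj₁ zero)    = zero
fromSide (true  ∷ U) (inj₁ (suc i)) = suc (fromSide U (inj₁ i))
fromSide (true  ∷ U) (inj₂ j)       = suc (fromSide U (inj₂ j))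
fromSide (false ∷ U) (inj₁ i)       = suc (fromSide U (inj₁ i))
fromSide (false ∷ U) (inj₂ zero)    = zero
fromSide (false ∷ U) (inj₂ (suc j)) = suc (fromSide U (inj₂ j))

fromSide∘toSide : ∀ (U : Subset n) v → fromSide U (toSide U v) ≡ v
fromSide∘toSide (true  ∷ U) zero    = refl
fromSide∘toSide (false ∷ U) zero    = refl
fromSide∘toSide (true  ∷ U) (suc v) with toSide U v | fromSide∘toSide U v
... | inj₁ _ | eq = cong suc eq
... | inj₂ _ | eq = cong suc eq
fromSide∘toSide (false ∷ U) (suc v) with toSide U v | fromSide∘toSide U v
... | inj₁ _ | eq = cong suc eq
... | inj₂ _ | eq = cong suc eq

toSide∘fromSide : ∀ (U : Subset n) x → toSide U (fromSide U x) ≡ x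
toSide∘fromSide (true  ∷ U) (inj₁ zero)    = refl
toSide∘fromSide (true  ∷ U) (inj₁ (suc i)) = cong (map₁ suc) (toSide∘fromSide U (inj₁ i))
toSide∘fromSide (true  ∷ U) (inj₂ j)       = cong (map₁ suc) (toSide∘fromSide U (inj₂ j))
toSide∘fromSide (false ∷ U) (inj₁ i)       = cong (map₂ suc) (toSide∘fromSide U (inj₁ i))
toSide∘fromSide (false ∷ U) (inj₂ zero)    = refl
toSide∘fromSide (false ∷ U) (inj₂ (suc j)) = cong (map₂ suc) (toSide∘fromSide U (inj₂ j))

fromSide-injective : ∀ (U : Subset n) {x y} → fromSide U x ≡ fromSide U y → x ≡ y
fromSide-injective U {x} {y} eq =
  trans (sym (toSide∘fromSide U x)) (trans (cong (toSide U) eq) (toSide∘fromSide U y))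

fromSide-inj₁∈ : ∀ (U : Subset n) i → fromSide U (inj₁ i) ∈ U
fromSide-inj₁∈ (true  ∷ U) zero    = here
fromSide-inj₁∈ (true  ∷ U) (suc i) = there (fromSide-inj₁∈ U i)
fromSide-inj₁∈ (false ∷ U) i       = there (fromSide-inj₁∈ U i)

fromSide-inj₂∉ : ∀ (U : Subset n) j → fromSide U (inj₂ j) ∉ U
fromSide-inj₂∉ (true  ∷ U) j       = fromSide-inj₂∉ U j ∘ drop-there
fromSide-inj₂∉ (false ∷ U) zero    = λ ()
fromSide-inj₂∉ (false ∷ U) (suc j) = fromSide-inj₂∉ U j ∘ drop-there

toSide≡⇒≡fromSide : ∀ (U : Subset n) {v x} → toSide U v ≡ x → v ≡ fromSide U x
toSide≡⇒≡fromSide U {v} eq = trans (sym (fromSide∘toSide U v)) (cong (fromSide U) eq)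

toSide≡inj₁⇒∈ : ∀ (U : Subset n) {v i} → toSide U v ≡ inj₁ i → v ∈ U
toSide≡inj₁⇒∈ U eq = subst (_∈ U) (sym (toSide≡⇒≡fromSide U eq)) (fromSide-inj₁∈ U _)

toSide≡inj₂⇒∉ : ∀ (U : Subset n) {v j} → toSide U v ≡ inj₂ j → v ∉ U
toSide≡inj₂⇒∉ U eq = subst (_∉ U) (sym (toSide≡⇒≡fromSide U eq)) (fromSide-inj₂∉ U _)

induced : Graph n → (Fin m → Fin n) → Graph m
induced G e = record
  { adj    = λ i j → adj G (e i) (e j)
  ; sym    = λ i j → Graph.sym G (e i) (e j)
  ; irrefl = λ i → irrefl G (e i)
  }

Universal : Graph n → Fin n → Set
Universal G w = ∀ y → y ≢ w → adj G w y ≡ true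

UniversalOutside : Graph n → Subset n → Set
UniversalOutside G U = ∀ w → w ∉ U → Universal G w

module _ (G : Graph n) (U : Subset n) (universal : UniversalOutside G U) where

  private
    H : Graph ∣ U ∣
    H = induced G (fromSide U ∘ inj₁)

    K : Graph ∣ ∁ U ∣
    K = complete ∣ ∁ U ∣

    inj₁≢inj₂ : ∀ i j → fromSide U (inj₁ i) ≢ fromSide U (inj₂ j)
    inj₁≢inj₂ i j eq = fromSide-inj₂∉ U j (subst (_∈ U) eq (fromSide-inj₁∈ U i))

    adj-fromSide : ∀ x y → adj G (fromSide U x) (fromSide U y) ≡ jadj H K x y
    adj-fromSide (inj₁ i) (inj₁ j) = refl
    adj-fromSide (inj₁ i) (inj₂ j) =
      trans (Graph.sym G _ _) (universal _ (fromSide-inj₂∉ U j) _ (inj₁≢inj₂ i j))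
    adj-fromSide (inj₂ i) (inj₁ j) = universal _ (fromSide-inj₂∉ U i) _ (inj₁≢inj₂ j i)
    adj-fromSide (inj₂ i) (inj₂ j) with i ≟ j
    ... | yes refl = irrefl G _
    ... | no i≢j   =
      universal _ (fromSide-inj₂∉ U i) _ (i≢j ∘ sym ∘ inj₂-injective ∘ fromSide-injective U)

  universalOutside⇒≅join : Σ (Graph ∣ U ∣) λ H → G ≅ join H (complete ∣ ∁ U ∣)
  universalOutside⇒≅join = H , σ , adj-preserved
    where
    a = ∣ U ∣
    b = ∣ ∁ U ∣

    σ : Fin n ↔ Fin (a + b)
    σ = mk↔ₛ′ (Fin.join a b ∘ toSide U) (fromSide U ∘ splitAt a)
      (λ y → trans (cong (Fin.join a b) (toSide∘fromSide U (splitAt a y))) (join-splitAt a b y))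
      (λ v → trans (cong (fromSide U) (splitAt-join a b (toSide U v))) (fromSide∘toSide U v))

    adj-preserved : ∀ u v → adj G u v ≡ adj (join H K) (Inverse.to σ u) (Inverse.to σ v)
    adj-preserved u v = begin
      adj G u v
        ≡⟨ cong₂ (adj G) (fromSide∘toSide U u) (fromSide∘toSide U v) ⟨
      adj G (fromSide U (toSide U u)) (fromSide U (toSide U v))
        ≡⟨ adj-fromSide (toSide U u) (toSide U v) ⟩
      jadj H K (toSide U u) (toSide U v)
        ≡⟨ cong₂ (jadj H K) (splitAt-join a b (toSide U u)) (splitAt-join a b (toSide U v)) ⟨
      adj (join H K) (Inverse.to σ u) (Inverse.to σ v)
        ∎
      where open ≡-Reasoning

∣⊤++⊥∣≡a : ∀ a {b} → ∣ ⊤ {a} ++ ⊥ {b} ∣ ≡ a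
∣⊤++⊥∣≡a zero    {b} = ∣⊥∣≡0 b
∣⊤++⊥∣≡a (suc a)     = cong suc (∣⊤++⊥∣≡a a)

↑ˡ∈⊤++⊥ : ∀ {a} b (i : Fin a) → i ↑ˡ b ∈ ⊤ {a} ++ ⊥ {b}
↑ˡ∈⊤++⊥ b zero    = here
↑ˡ∈⊤++⊥ b (suc i) = there (↑ˡ∈⊤++⊥ b i)

kadj-≢ : ∀ {i j : Fin m} → i ≢ j → kadj i j ≡ true
kadj-≢ {i = i} {j} i≢j with i ≟ j
... | yes i≡j = contradiction i≡j i≢j
... | no _    = refl

join-universal : ∀ {a b} (H : Graph a) x → x ∉ ⊤ {a} ++ ⊥ {b} → Universal (join H (complete b)) x
join-universal {a} {b} H x x∉left y y≢x with splitAt a x in eqx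
... | inj₁ i = contradiction (subst (_∈ ⊤ {a} ++ ⊥ {b}) (splitAt⁻¹ eqx) (↑ˡ∈⊤++⊥ b i)) x∉left
  where
  splitAt⁻¹ : ∀ {z s} → splitAt a z ≡ s → Fin.join a b s ≡ z
  splitAt⁻¹ {z} eq = trans (cong (Fin.join a b) (sym eq)) (join-splitAt a b z)
... | inj₂ j with splitAt a y in eqy
...   | inj₁ _  = refl
...   | inj₂ j′ = kadj-≢ λ { refl → y≢x (splitAt-injective (trans eqy (sym eqx))) }
  where
  splitAt-injective : ∀ {z z′} → splitAt a z ≡ splitAt a z′ → z ≡ z′
  splitAt-injective {z} {z′} eq =
    trans (sym (join-splitAt a b z)) (trans (cong (Fin.join a b) eq) (join-splitAt a b z′))

≅-reflects-Universal : ∀ {G : Graph n} {J : Graph m} (iso : G ≅ J) {w} →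
  Universal J (Inverse.to (proj₁ iso) w) → Universal G w
≅-reflects-Universal (σ , adj-preserved) {w} universal y y≢w =
  trans (adj-preserved w y) (universal (to y) (y≢w ∘ to-injective))
  where
  open Inverse σ
  to-injective : ∀ {u v} → to u ≡ to v → u ≡ v
  to-injective {u} {v} eq = trans (sym (strictlyInverseʳ u)) (trans (cong from eq) (strictlyInverseʳ v))

↔⇒∣preimage∣≡∣D∣ : (σ : Fin n ↔ Fin m) → ∀ D → ∣ preimage (Inverse.to σ) D ∣ ≡ ∣ D ∣
↔⇒∣preimage∣≡∣D∣ σ D = ≤-antisym
  (leftInverse⇒∣preimage∣≤∣D∣ from strictlyInverseʳ D)
  (surjective⇒∣D∣≤∣preimage∣ (λ y → from y , λ { refl → strictlyInverseˡ y }) D)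
  where open Inverse σ

≅join⇒UniversalOutside : ∀ {G : Graph n} {a b} {H : Graph a} → G ≅ join H (complete b) →
  Σ (Subset n) λ U → ∣ U ∣ ≡ a × UniversalOutside G U
≅join⇒UniversalOutside {G = G} {a} {b} {H} iso@(σ , _) =
  preimage (Inverse.to σ) left ,
  trans (↔⇒∣preimage∣≡∣D∣ σ left) (∣⊤++⊥∣≡a a) ,
  λ w w∉U → ≅-reflects-Universal {G = G} {J = join H (complete b)} iso
    (join-universal H (Inverse.to σ w) (w∉U ∘ ∈-preimage⁺))
  where
  left : Subset (a + b)
  left = ⊤ {a} ++ ⊥ {b}

-- k-domination and coalition partitions

module _ (G : Graph n) {k : ℕ} {S : Subset n} where

  KDominating⇒k≤∣S∣ : k ≤ n → KDominating G k S → k ≤ ∣ S ∣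
  KDominating⇒k≤∣S∣ k≤n dom with ∣ S ∣ <? n
  ... | yes ∣S∣<n = let v , v∉S = ∣p∣<n⇒∃∉ S ∣S∣<n in ≤-trans (dom v v∉S) (∣p∩q∣≤∣p∣ S (N G v))
  ... | no ∣S∣≮n = ≤-trans k≤n (≮⇒≥ ∣S∣≮n)

  small⇒¬KDominating : ∣ S ∣ < k → ∀ {v} → v ∉ S → ¬ KDominating G k S
  small⇒¬KDominating ∣S∣<k {v} v∉S dom = <⇒≱ ∣S∣<k (≤-trans (dom v v∉S) (∣p∩q∣≤∣p∣ S (N G v)))

  KDominating⇒⊆N : KDominating G k S → ∣ S ∣ ≤ k → ∀ {w} → w ∉ S → S ⊆ N G w
  KDominating⇒⊆N dom ∣S∣≤k {w} w∉S = ∣p∣≤∣p∩q∣⇒p⊆q (≤-trans ∣S∣≤k (dom w w∉S))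

  universal⇒KDominating : k ≤ ∣ S ∣ → UniversalOutside G S → KDominating G k S
  universal⇒KDominating k≤∣S∣ universal v v∉S = ≤-trans k≤∣S∣ (p⊆q⇒∣p∣≤∣q∣ S⊆S∩Nv)
    where
    S⊆S∩Nv : S ⊆ S ∩ N G v
    S⊆S∩Nv {y} y∈S = x∈p∩q⁺ (y∈S , ∈-tabulate⁺ (universal v v∉S y λ { refl → v∉S y∈S }))

universalOutside⇒KDominating-∪⁅⁆ : ∀ (G : Graph n) {k U} → suc ∣ U ∣ ≡ k → UniversalOutside G U →
  ∀ w → w ∉ U → KDominating G k (U ∪ ⁅ w ⁆)
universalOutside⇒KDominating-∪⁅⁆ G 1+∣U∣≡k universal w w∉U =
  universal⇒KDominating G (≤-reflexive (trans (sym 1+∣U∣≡k) (sym (∣p∪⁅x⁆∣≡1+∣p∣ w∉U))))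
    (λ v v∉U∪⁅w⁆ → universal v (v∉U∪⁅w⁆ ∘ x∈p∪q⁺ ∘ inj₁))

module _ (f : Fin n → Fin m) where

  ∈-part∪part⁻ : ∀ {i j v} → v ∈ part f i ∪ part f j → f v ≡ i ⊎ f v ≡ j
  ∈-part∪part⁻ {i} {j} = Sum.map ∈-part⁻ ∈-part⁻ ∘ x∈p∪q⁻ (part f i) (part f j)

  part⊆preimage⁅⁆ : ∀ i → part f i ⊆ preimage f ⁅ i ⁆
  part⊆preimage⁅⁆ i = ∈-preimage⁺ ∘ Equivalence.from x∈⁅y⁆⇔x≡y ∘ ∈-part⁻

  part∪part⊆preimage : ∀ i j → part f i ∪ part f j ⊆ preimage f (⁅ i ⁆ ∪ ⁅ j ⁆)
  part∪part⊆preimage i j = ∈-preimage⁺ ∘ x∈⁅y⁆∪⁅z⁆⁺ ∘ ∈-part∪part⁻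

coalitionPartition-bound : ∀ (G : Graph n) {k} → k ≤ n →
  (f : Fin n → Fin m) → IsKCoalitionPartition G k f → m ≤ n ∸ k + 2
coalitionPartition-bound {m = zero}  G k≤n f _                = z≤n
coalitionPartition-bound {n} {suc m} G {k} k≤n f (surj , classes) =
  subst (suc m ≤_) (+-∸-comm 2 k≤n)
    (m+n≤o⇒m≤o∸n (suc m) (subst (_≤ n + 2) (+-comm k (suc m)) k+m≤n+2))
  where
  covering-pair : ∃ λ j → k ≤ ∣ part f zero ∪ part f j ∣
  covering-pair with classes zero
  ... | inj₁ (_ , ∣part∣≡k) =
    zero , ≤-trans (≤-reflexive (sym ∣part∣≡k)) (∣p∣≤∣p∪q∣ (part f zero) (part f zero))
  ... | inj₂ (j , _ , _ , _ , _ , dom) = j , KDominating⇒k≤∣S∣ G k≤n dom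

  j = proj₁ covering-pair

  k+m≤n+2 : k + suc m ≤ n + 2
  k+m≤n+2 = begin
    k + suc m
      ≤⟨ +-monoˡ-≤ (suc m) (≤-trans (proj₂ covering-pair) (p⊆q⇒∣p∣≤∣q∣ (part∪part⊆preimage f zero j))) ⟩
    ∣ preimage f (⁅ zero ⁆ ∪ ⁅ j ⁆) ∣ + suc m
      ≤⟨ surjective⇒∣preimage∣+m≤n+∣D∣ surj _ ⟩
    n + ∣ ⁅ zero ⁆ ∪ ⁅ j ⁆ ∣
      ≤⟨ +-monoʳ-≤ n (∣⁅x⁆∪⁅y⁆∣≤2 zero j) ⟩
    n + 2
      ∎
    where open ≤-Reasoning

-- n + 2 ≡ k + M says M = n ∸ k + 2 without truncated subtraction.
module ExtremalPartition
  (G : Graph n) {k M : ℕ} (f : Fin n → Fin M) (isPartition : IsKCoalitionPartition G k f)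
  (n+2≡k+M : n + 2 ≡ k + M) (2<k : 2 < k) (2<M : 2 < M) where

  private
    V : Fin M → Subset n
    V = part f

    surj = proj₁ isPartition

    k≤n : k ≤ n
    k≤n = +-cancelʳ-≤ 2 k n (≤-trans (+-monoʳ-≤ k (<⇒≤ 2<M)) (≤-reflexive (sym n+2≡k+M)))

    M<n : M < n
    M<n = +-cancelˡ-≤ 2 (suc M) n (begin
      3 + M  ≤⟨ +-monoˡ-≤ M 2<k ⟩
      k + M  ≡⟨ n+2≡k+M ⟨
      n + 2  ≡⟨ +-comm n 2 ⟩
      2 + n  ∎)
      where open ≤-Reasoning

  -- the M ∸ ∣ D ∣ nonempty classes outside D leave at most ∣ D ∣ + k ∸ 2 vertices to the classes in D
  2+∣preimage∣≤∣D∣+k : ∀ D → 2 + ∣ preimage f D ∣ ≤ ∣ D ∣ + k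
  2+∣preimage∣≤∣D∣+k D = +-cancelʳ-≤ M (2 + ∣ preimage f D ∣) (∣ D ∣ + k) (begin
    2 + ∣ preimage f D ∣ + M  ≤⟨ s≤s (s≤s (surjective⇒∣preimage∣+m≤n+∣D∣ surj D)) ⟩
    2 + (n + ∣ D ∣)           ≡⟨ +-assoc 2 n ∣ D ∣ ⟨
    2 + n + ∣ D ∣             ≡⟨ cong (_+ ∣ D ∣) (trans (+-comm 2 n) n+2≡k+M) ⟩
    k + M + ∣ D ∣             ≡⟨ trans (+-comm (k + M) ∣ D ∣) (sym (+-assoc ∣ D ∣ k M)) ⟩
    ∣ D ∣ + k + M             ∎)
    where open ≤-Reasoning

  ∣V∣<k : ∀ i → ∣ V i ∣ < k
  ∣V∣<k i = ≤-pred (begin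
    2 + ∣ V i ∣                 ≤⟨ +-monoʳ-≤ 2 (p⊆q⇒∣p∣≤∣q∣ (part⊆preimage⁅⁆ f i)) ⟩
    2 + ∣ preimage f ⁅ i ⁆ ∣    ≤⟨ 2+∣preimage∣≤∣D∣+k ⁅ i ⁆ ⟩
    ∣ ⁅ i ⁆ ∣ + k               ≡⟨ cong (_+ k) (∣⁅x⁆∣≡1 i) ⟩
    1 + k                       ∎)
    where open ≤-Reasoning

  Partners : Fin M → Fin M → Set
  Partners i j = j ≢ i × KDominating G k (V i ∪ V j)

  partner : ∀ i → ∃ (Partners i)
  partner i with proj₂ isPartition i
  ... | inj₁ (_ , ∣V∣≡k)                = contradiction ∣V∣≡k (<⇒≢ (∣V∣<k i))
  ... | inj₂ (j , j≢i , _ , _ , _ , dom) = j , j≢i , dom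

  ∣V∣≤1-outside-partners : ∀ {c d e} → Partners c d → e ≢ c → e ≢ d → ∣ V e ∣ ≤ 1
  ∣V∣≤1-outside-partners {c} {d} {e} (_ , dom) e≢c e≢d =
    +-cancelˡ-≤ k ∣ V e ∣ 1 (≤-trans (≤-pred (≤-pred (begin
      2 + (k + ∣ V e ∣)                ≤⟨ +-monoʳ-≤ 2 (+-monoˡ-≤ ∣ V e ∣ (KDominating⇒k≤∣S∣ G k≤n dom)) ⟩
      2 + (∣ V c ∪ V d ∣ + ∣ V e ∣)     ≡⟨ cong (2 +_) (∣p∪q∣≡∣p∣+∣q∣ disjoint) ⟨
      2 + ∣ (V c ∪ V d) ∪ V e ∣         ≤⟨ +-monoʳ-≤ 2 (p⊆q⇒∣p∣≤∣q∣ ⊆preimage) ⟩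
      2 + ∣ preimage f D ∣              ≤⟨ 2+∣preimage∣≤∣D∣+k D ⟩
      ∣ D ∣ + k                         ≤⟨ +-monoˡ-≤ k ∣D∣≤3 ⟩
      3 + k                             ∎))) (≤-reflexive (+-comm 1 k)))
    where
    open ≤-Reasoning
    D = (⁅ c ⁆ ∪ ⁅ d ⁆) ∪ ⁅ e ⁆

    ∣D∣≤3 : ∣ D ∣ ≤ 3
    ∣D∣≤3 = ≤-trans (∣p∪q∣≤∣p∣+∣q∣ (⁅ c ⁆ ∪ ⁅ d ⁆) ⁅ e ⁆)
      (+-mono-≤ (∣⁅x⁆∪⁅y⁆∣≤2 c d) (≤-reflexive (∣⁅x⁆∣≡1 e)))

    ⊆preimage : (V c ∪ V d) ∪ V e ⊆ preimage f D
    ⊆preimage v∈ = ∈-preimage⁺ (x∈p∪q⁺ (Sum.map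
      (x∈⁅y⁆∪⁅z⁆⁺ ∘ ∈-part∪part⁻ f) (Equivalence.from x∈⁅y⁆⇔x≡y ∘ ∈-part⁻)
      (x∈p∪q⁻ (V c ∪ V d) (V e) v∈)))

    disjoint : Disjoint (V c ∪ V d) (V e)
    disjoint (v , v∈) with x∈p∩q⁻ (V c ∪ V d) (V e) v∈
    ... | v∈V∪V , v∈Ve with ∈-part∪part⁻ f v∈V∪V
    ...   | inj₁ fv≡c = e≢c (trans (sym (∈-part⁻ v∈Ve)) fv≡c)
    ...   | inj₂ fv≡d = e≢d (trans (sym (∈-part⁻ v∈Ve)) fv≡d)

  crowded : ∃ λ c → 2 ≤ ∣ V c ∣
  crowded with pigeonhole M<n f
  ... | u , v , u<v , fu≡fv = f u , subst (_≤ ∣ V (f u) ∣) (∣⁅x⁆∪⁅y⁆∣≡2 (Finₚ.<⇒≢ u<v)) (p⊆q⇒∣p∣≤∣q∣ ⊆V)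
    where
    ⊆V : ⁅ u ⁆ ∪ ⁅ v ⁆ ⊆ V (f u)
    ⊆V x∈ with x∈p∪q⁻ ⁅ u ⁆ ⁅ v ⁆ x∈
    ... | inj₁ x∈⁅u⁆ = ∈-part⁺ (cong f (x∈⁅y⁆⇒x≡y u x∈⁅u⁆))
    ... | inj₂ x∈⁅v⁆ = ∈-part⁺ (trans (cong f (x∈⁅y⁆⇒x≡y v x∈⁅v⁆)) (sym fu≡fv))

  private
    c = proj₁ crowded

  partner≡c : ∀ {x y} → x ≢ c → Partners x y → y ≡ c
  partner≡c {x} {y} x≢c x,y-partners with y ≟ c
  ... | yes y≡c = y≡c
  ... | no y≢c  = contradiction
    (≤-trans (proj₂ crowded) (∣V∣≤1-outside-partners x,y-partners (x≢c ∘ sym) (y≢c ∘ sym)))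
    λ { (s≤s ()) }

  ∣V∣≤1 : ∀ {e} → e ≢ c → ∣ V e ∣ ≤ 1
  ∣V∣≤1 {e} e≢c with ∃≢₂ 2<M c e
  ... | x , x≢c , x≢e with partner x
  ...   | y , x,y-partners =
    ∣V∣≤1-outside-partners x,y-partners (x≢e ∘ sym) (λ e≡y → e≢c (trans e≡y (partner≡c x≢c x,y-partners)))

  1+∣Vc∣≡k : suc ∣ V c ∣ ≡ k
  1+∣Vc∣≡k with partner c
  ... | d , d≢c , dom = ≤-antisym (∣V∣<k c) (begin
    k                  ≤⟨ KDominating⇒k≤∣S∣ G k≤n dom ⟩
    ∣ V c ∪ V d ∣      ≤⟨ ∣p∪q∣≤∣p∣+∣q∣ (V c) (V d) ⟩
    ∣ V c ∣ + ∣ V d ∣  ≤⟨ +-monoʳ-≤ ∣ V c ∣ (∣V∣≤1 d≢c) ⟩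
    ∣ V c ∣ + 1        ≡⟨ +-comm ∣ V c ∣ 1 ⟩
    suc ∣ V c ∣        ∎)
    where open ≤-Reasoning

  V∪Vc⊆N : ∀ {w z} → w ∉ V c → z ∉ V c → z ≢ w → V (f z) ∪ V c ⊆ N G w
  V∪Vc⊆N {w} {z} w∉Vc z∉Vc z≢w = KDominating⇒⊆N G dom ∣S∣≤k w∉S
    where
    fz≢c : f z ≢ c
    fz≢c = z∉Vc ∘ ∈-part⁺

    dom : KDominating G k (V (f z) ∪ V c)
    dom with partner (f z)
    ... | y , fz,y-partners = subst (λ y → KDominating G k (V (f z) ∪ V y))
      (partner≡c fz≢c fz,y-partners) (proj₂ fz,y-partners)

    ∣S∣≤k : ∣ V (f z) ∪ V c ∣ ≤ k
    ∣S∣≤k = begin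
      ∣ V (f z) ∪ V c ∣      ≤⟨ ∣p∪q∣≤∣p∣+∣q∣ (V (f z)) (V c) ⟩
      ∣ V (f z) ∣ + ∣ V c ∣  ≤⟨ +-monoˡ-≤ ∣ V c ∣ (∣V∣≤1 fz≢c) ⟩
      suc ∣ V c ∣            ≡⟨ 1+∣Vc∣≡k ⟩
      k                      ∎
      where open ≤-Reasoning

    w∉S : w ∉ V (f z) ∪ V c
    w∉S w∈ with x∈p∪q⁻ (V (f z)) (V c) w∈
    ... | inj₁ w∈Vfz = z≢w (∣p∣≤1⇒≡ (∣V∣≤1 fz≢c) (∈-part⁺ refl) w∈Vfz)
    ... | inj₂ w∈Vc  = w∉Vc w∈Vc

  universal : UniversalOutside G (V c)
  universal w w∉Vc y y≢w with y ∈? V c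
  ... | no y∉Vc  = ∈-tabulate⁻ (V∪Vc⊆N w∉Vc y∉Vc y≢w (x∈p∪q⁺ (inj₁ (∈-part⁺ refl))))
  ... | yes y∈Vc with ∃≢₂ 2<M c (f w)
  ...   | x , x≢c , x≢fw with surj x
  ...     | z , fz≡x = ∈-tabulate⁻ (V∪Vc⊆N w∉Vc z∉Vc z≢w (x∈p∪q⁺ (inj₂ y∈Vc)))
    where
    z∉Vc : z ∉ V c
    z∉Vc = x≢c ∘ trans (sym (fz≡x refl)) ∘ ∈-part⁻

    z≢w : z ≢ w
    z≢w z≡w = x≢fw (trans (sym (fz≡x refl)) (cong f z≡w))

  core : Σ (Subset n) λ U → suc ∣ U ∣ ≡ k × UniversalOutside G U
  core = V c , 1+∣Vc∣≡k , universal

KCoalition-sym : ∀ {G : Graph n} {k A B} → KCoalition G k A B → KCoalition G k B A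
KCoalition-sym {G = G} {k} {A} {B} (disjoint , ¬domA , ¬domB , dom) =
  disjoint ∘ Product.map₂ (subst (_ ∈_) (∩-comm B A)) , ¬domB , ¬domA ,
  subst (KDominating G k) (∪-comm A B) dom

∣∁p∣≡n∸k+1 : ∀ (p : Subset n) {k} → suc ∣ p ∣ ≡ k → k ≤ n → ∣ ∁ p ∣ ≡ n ∸ k + 1
∣∁p∣≡n∸k+1 {n} p {k} refl k≤n =
  trans (∣∁p∣≡n∸∣p∣ p) (trans (cong (_∸ k) (+-comm 1 n)) (+-∸-comm 1 k≤n))

module CoreAndSingletons (G : Graph n) {k : ℕ} (U : Subset n)
  (k≤n : k ≤ n) (2≤k : 2 ≤ k) (1+∣U∣≡k : suc ∣ U ∣ ≡ k)
  (completes : ∀ w → w ∉ U → KDominating G k (U ∪ ⁅ w ⁆)) where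

  classOf : Fin n → Fin (suc ∣ ∁ U ∣)
  classOf = [ const zero , suc ]′ ∘ toSide U

  private
    u₀ : Fin n
    u₀ = fromSide U (inj₁ (Fin.fromℕ< (≤-pred (subst (2 ≤_) (sym 1+∣U∣≡k) 2≤k))))

    j₀ : Fin ∣ ∁ U ∣
    j₀ = Fin.fromℕ< (subst (0 <_) (sym (∣∁p∣≡n∸∣p∣ U))
      (m<n⇒0<n∸m (≤-trans (≤-reflexive 1+∣U∣≡k) k≤n)))

    classOf-fromSide : ∀ x → classOf (fromSide U x) ≡ [ const zero , suc ]′ x
    classOf-fromSide x = cong [ const zero , suc ]′ (toSide∘fromSide U x)

  ∈U⇒classOf≡0 : ∀ {v} → v ∈ U → classOf v ≡ zero
  ∈U⇒classOf≡0 {v} v∈U with toSide U v in eq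
  ... | inj₁ _ = refl
  ... | inj₂ _ = contradiction v∈U (toSide≡inj₂⇒∉ U eq)

  part-zero : part classOf zero ≡ U
  part-zero = ⊆-antisym part⊆U (∈-part⁺ ∘ ∈U⇒classOf≡0)
    where
    part⊆U : part classOf zero ⊆ U
    part⊆U {v} v∈part with toSide U v in eq | ∈-part⁻ v∈part
    ... | inj₁ _ | _ = toSide≡inj₁⇒∈ U eq

  part-suc : ∀ j → part classOf (suc j) ≡ ⁅ fromSide U (inj₂ j) ⁆
  part-suc j = ⊆-antisym part⊆⁅⁆ (∈-part⁺ ∘ ⁅⁆⊆part)
    where
    part⊆⁅⁆ : part classOf (suc j) ⊆ ⁅ fromSide U (inj₂ j) ⁆
    part⊆⁅⁆ {v} v∈part with toSide U v in eq | ∈-part⁻ v∈part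
    ... | inj₂ _ | refl = Equivalence.from x∈⁅y⁆⇔x≡y (toSide≡⇒≡fromSide U eq)

    ⁅⁆⊆part : ∀ {v} → v ∈ ⁅ fromSide U (inj₂ j) ⁆ → classOf v ≡ suc j
    ⁅⁆⊆part v∈⁅⁆ = trans (cong classOf (x∈⁅y⁆⇒x≡y _ v∈⁅⁆)) (classOf-fromSide (inj₂ j))

  coalition : ∀ w → w ∉ U → KCoalition G k U ⁅ w ⁆
  coalition w w∉U =
    x∉p⇒Disjoint w∉U ,
    small⇒¬KDominating G (≤-reflexive 1+∣U∣≡k) w∉U ,
    ¬dom⁅w⁆ ,
    completes w w∉U
    where
    ¬dom⁅w⁆ : ¬ KDominating G k ⁅ w ⁆
    ¬dom⁅w⁆ = small⇒¬KDominating G (subst (_< k) (sym (∣⁅x⁆∣≡1 w)) 2≤k)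
      {u₀} (λ u₀∈⁅w⁆ → w∉U (subst (_∈ U) (x∈⁅y⁆⇒x≡y w u₀∈⁅w⁆) (fromSide-inj₁∈ U _)))

  isPartition : IsKCoalitionPartition G k classOf
  isPartition = surjective , classes
    where
    surjective : Surjective _≡_ _≡_ classOf
    surjective zero    = u₀ , λ { refl → classOf-fromSide (inj₁ _) }
    surjective (suc j) = fromSide U (inj₂ j) , λ { refl → classOf-fromSide (inj₂ j) }

    classes : ∀ i → (KDominating G k (part classOf i) × ∣ part classOf i ∣ ≡ k)
      ⊎ Σ (Fin (suc ∣ ∁ U ∣)) (λ j → j ≢ i × KCoalition G k (part classOf i) (part classOf j))
    classes zero = inj₂ (suc j₀ , (λ ()) ,
      subst₂ (KCoalition G k) (sym part-zero) (sym (part-suc j₀)) (coalition _ (fromSide-inj₂∉ U j₀)))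
    classes (suc j) = inj₂ (zero , (λ ()) ,
      subst₂ (KCoalition G k) (sym (part-suc j)) (sym part-zero)
        (KCoalition-sym {G = G} (coalition _ (fromSide-inj₂∉ U j))))

  partition : Σ (Fin n → Fin (n ∸ k + 2)) (IsKCoalitionPartition G k)
  partition = subst (λ m → Σ (Fin n → Fin m) (IsKCoalitionPartition G k))
    (trans (cong suc (∣∁p∣≡n∸k+1 U 1+∣U∣≡k k≤n)) (sym (+-suc (n ∸ k) 1)))
    (classOf , isPartition)

core⇒≅join : ∀ (G : Graph n) {k} → k ≤ n →
  Σ (Subset n) (λ U → suc ∣ U ∣ ≡ k × UniversalOutside G U) →
  Σ (Graph (k ∸ 1)) λ H → G ≅ join H (complete (n ∸ k + 1))
core⇒≅join G k≤n (U , 1+∣U∣≡k , universal) =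
  subst₂ (λ a b → Σ (Graph a) λ H → G ≅ join H (complete b))
    (cong (_∸ 1) 1+∣U∣≡k) (∣∁p∣≡n∸k+1 U 1+∣U∣≡k k≤n) (universalOutside⇒≅join G U universal)

theorem2p2 : (n : ℕ) → 3 ≤ n → (G : Graph n) → (k : ℕ) → 3 ≤ k → k ≤ n →
    ((m : ℕ) (f : Fin n → Fin m) → IsKCoalitionPartition G k f → m ≤ n ∸ k + 2)
    × (IsCoalitionNumber G k (n ∸ k + 2)
       ⇔ (n ≡ k ⊎ Σ (Graph (k ∸ 1)) (λ H → G ≅ join H (complete (n ∸ k + 1)))))
theorem2p2 n 3≤n G k 3≤k k≤n = bound , mk⇔ extremal⇒join join⇒extremal
  where
  bound : (m : ℕ) (f : Fin n → Fin m) → IsKCoalitionPartition G k f → m ≤ n ∸ k + 2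
  bound _ = coalitionPartition-bound G k≤n

  2≤k : 2 ≤ k
  2≤k = <⇒≤ 3≤k

  Join : Set
  Join = Σ (Graph (k ∸ 1)) (λ H → G ≅ join H (complete (n ∸ k + 1)))

  extremal⇒join : IsCoalitionNumber G k (n ∸ k + 2) → n ≡ k ⊎ Join
  extremal⇒join ((f , isPartition) , _) with n ℕ.≟ k
  ... | yes n≡k = inj₁ n≡k
  ... | no n≢k  = inj₂ (core⇒≅join G k≤n (ExtremalPartition.core G f isPartition
    (trans (cong (_+ 2) (sym (m+[n∸m]≡n k≤n))) (+-assoc k (n ∸ k) 2)) 3≤k
    (+-monoˡ-≤ 2 (m<n⇒0<n∸m (≤∧≢⇒< k≤n (n≢k ∘ sym))))))

  join⇒extremal : n ≡ k ⊎ Join → IsCoalitionNumber G k (n ∸ k + 2)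
  join⇒extremal (inj₁ n≡k) =
    CoreAndSingletons.partition G (∁ ⁅ v₀ ⁆) k≤n 2≤k (trans (1+∣∁⁅x⁆∣≡n v₀) n≡k)
      (λ w w∉U v v∉S → contradiction (x∉∁⁅y⁆⇒z∈∁⁅y⁆∪⁅x⁆ w∉U v) v∉S) , bound
    where
    v₀ : Fin n
    v₀ = Fin.fromℕ< (≤-trans (s≤s z≤n) 3≤n)
  join⇒extremal (inj₂ (H , iso)) =
    let U , ∣U∣≡k∸1 , universal = ≅join⇒UniversalOutside {G = G} iso
        1+∣U∣≡k = trans (cong suc ∣U∣≡k∸1) (m+[n∸m]≡n (≤-trans (s≤s z≤n) 3≤k))
    in CoreAndSingletons.partition G U k≤n 2≤k 1+∣U∣≡k
         (universalOutside⇒KDominating-∪⁅⁆ G 1+∣U∣≡k universal) , bound
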